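{- There exist quasi-discrete neighbourhood models $\mathcal{M}_1$ and $\mathcal{M}_2$ and a path preserving bisimulation between them such that the underlying space of $\mathcal{M}_1$ is topological while the underlying space of $\mathcal{M}_2$ is not topological.
   Context: A neighbourhood space $(X,\mathcal{N})$ assigns to each $x\in X$ a filter $\mathcal{N}(x)$ on $X$ (closed under non-empty finite intersections and supersets, $\emptyset\notin\mathcal{N}(x)$) with $x\in N$ for all $N\in\mathcal{N}(x)$. It is quasi-discrete if every $x$ has a minimal neighbourhood (a member of $\mathcal{N}(x)$ contained in all others). It is topological if for every $x$ and $N\in\mathcal{N}(x)$ there is $M\in\mathcal{N}(x)$ with $N\in\mathcal{N}(y)$ for all $y\in M$. A map $f$ between neighbourhood spaces is continuous if $f^{ -1}[N_2]\in\mathcal{N}_1(x)$ for all $x$ and $N_2\in\mathcal{N}_2(f(x))$. A quasi-discrete neighbourhood model is $((X,\mathcal{N}),\mathbb{N},V)$ with $(X,\mathcal{N})$ quasi-discrete, $V:X\to\mathcal{P}(\mathsf{P})$ a valuation of atoms, and index space $\mathbb{N}$ with usual order, least element $0$, and neighbourhood system in which the minimal neighbourhood of $n$ is $\{n,n+1\}$; paths are continuous maps $p:\mathbb{N}\to X$. Neighbourhood bisimulation conditions for a pair $x_1 Z x_2$ with $Z\subseteq X_1\times X_2$: (atomic) $V_1(x_1)=V_2(x_2)$; (forth) for every $N_2\in\mathcal{N}_2(x_2)$ there is $N_1\in\mathcal{N}_1(x_1)$ such that every $y_1\in N_1$ has some $y_2\in N_2$ with $y_1Zy_2$; (back) for every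 $N_1\in\mathcal{N}_1(x_1)$ there is $N_2\in\mathcal{N}_2(x_2)$ such that every $y_2\in N_2$ has some $y_1\in N_1$ with $y_1Zy_2$. Path preserving bisimulation between models $\mathcal{M}_1,\mathcal{M}_2$ with common index set $I$ (here $\mathbb{N}$) and path sets $\mathcal{P}_1,\mathcal{P}_2$: a triple $(Z_{\mathcal{N}},Z_1,Z_2)$ with $\emptyset\ne Z_{\mathcal{N}}\subseteq X_1\times X_2$, $Z_1\subseteq(\mathcal{P}_1\times I)\times(\mathcal{P}_2\times I)$, $Z_2\subseteq(\mathcal{P}_2\times I)\times(\mathcal{P}_1\times I)$ such that: (1) every pair in $Z_{\mathcal{N}}$ satisfies the neighbourhood bisimulation conditions w.r.t. $Z_{\mathcal{N}}$; (2) if $x_1Z_{\mathcal{N}}x_2$, $p$ a path with $p(0)=x_1$, $n\ne0$, then there are a path $q$ with $q(0)=x_2$ and $m$ with $p(n)Z_{\mathcal{N}}q(m)$ and $(p,n)Z_1(q,m)$; (3) if $x_1Z_{\mathcal{N}}x_2$, $p$ a path with $p(n)=x_1$, $n\ne0$, then there are a path $q$ and $m$ with $q(m)=x_2$, $p(0)Z_{\mathcal{N}}q(0)$ and $(p,n)Z_1(q,m)$; (4) if $(p,n)Z_1(q,m)$ and $0<k_q<m$, then there is $k_p$ with $0<k_p<n$ and $p(k_p)Z_{\mathcal{N}}q(k_q)$; (5) if $x_1Z_{\mathcal{N}}x_2$, $q$ a path with $q(0)=x_2$, $m\ne0$, then there are a path $p$ with $p(0)=x_1$ and $n$ with $p(n)Z_{\mathcal{N}}q(m)$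 and $(q,m)Z_2(p,n)$; (6) if $x_1Z_{\mathcal{N}}x_2$, $q$ a path with $q(m)=x_2$, $m\ne0$, then there are a path $p$ and $n$ with $p(n)=x_1$, $p(0)Z_{\mathcal{N}}q(0)$ and $(q,m)Z_2(p,n)$; (7) if $(q,m)Z_2(p,n)$ and $0<k_p<n$, then there is $k_q$ with $0<k_q<m$ and $p(k_p)Z_{\mathcal{N}}q(k_q)$. -}

module Defs where

open import Data.Nat using (ℕ; zero; suc; _<_)
open import Data.Product using (Σ; _×_; _,_; proj₁)
open import Data.Empty using (⊥)
open import Relation.Nullary using (¬_)
open import Relation.Binary.PropositionalEquality using (_≡_)
open import Function.Bundles using (_⇔_)

Subset : Set → Set₁
Subset X = X → Set

_⊆_ : {X : Set} → Subset X → Subset X → Set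
A ⊆ B = ∀ y → A y → B y

_∩_ : {X : Set} → Subset X → Subset X → Subset X
(A ∩ B) y = A y × B y

Full : (X : Set) → Subset X
Full X _ = Data.Unit.⊤ where import Data.Unit

record IsPointFilter {X : Set} (x : X) (F : Subset X → Set) : Set₁ where
  field
    full     : F (Full X)
    inter    : ∀ A B → F A → F B → F (A ∩ B)
    upward   : ∀ A B → F A → A ⊆ B → F B
    nonempty : ¬ F (λ _ → ⊥)
    contains : ∀ A → F A → A x

record NbhdSpace : Set₁ where
  field
    Carrier : Set
    𝒩       : Carrier → Subset Carrier → Set
    isFilt  : ∀ x → IsPointFilter x (𝒩 x)
open NbhdSpace public

QuasiDiscrete : NbhdSpace → Set₁
QuasiDiscrete S = ∀ x → Σ (Subset (Carrier S)) λ M →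
  𝒩 S x M × (∀ N → 𝒩 S x N → M ⊆ N)

Topological : NbhdSpace → Set₁
Topological S = ∀ x N → 𝒩 S x N →
  Σ (Subset (Carrier S)) λ M → 𝒩 S x M × (∀ y → M y → 𝒩 S y N)

Continuous : (S T : NbhdSpace) → (Carrier S → Carrier T) → Set₁
Continuous S T f = ∀ x N → 𝒩 T (f x) N → 𝒩 S x (λ y → N (f y))

ℕspace : NbhdSpace
ℕspace = record
  { Carrier = ℕ
  ; 𝒩 = λ n U → U n × U (suc n)
  ; isFilt = λ n → record
      { full = _ , _
      ; inter = λ A B (a , a') (b , b') → (a , b) , (a' , b')
      ; upward = λ A B (a , a') s → s n a , s (suc n) a'
      ; nonempty = λ ()
      ; contains = λ A (a , _) → a
      }
  }

record QDModel (Atom : Set) : Set₁ where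
  field
    space : NbhdSpace
    qd    : QuasiDiscrete space
    V     : Carrier space → Subset Atom
open QDModel public

Pt : {Atom : Set} → QDModel Atom → Set
Pt M = Carrier (space M)

-- Paths: continuous maps ℕ → X (the path set of a model is the set of all paths).
Path : {Atom : Set} → QDModel Atom → Set₁
Path M = Σ (ℕ → Pt M) (Continuous ℕspace (space M))

_at_ : {Atom : Set} {M : QDModel Atom} → Path M → ℕ → Pt M
_at_ p n = proj₁ p n

NbhdBisimAt : {Atom : Set} (M₁ M₂ : QDModel Atom) →
  (Pt M₁ → Pt M₂ → Set) → Pt M₁ → Pt M₂ → Set₁
NbhdBisimAt M₁ M₂ Z x₁ x₂ =
  (∀ a → V M₁ x₁ a ⇔ V M₂ x₂ a) ×
  (∀ N₂ → 𝒩 (space M₂) x₂ N₂ → Σ (Subset (Pt M₁)) λ N₁ → 𝒩 (space M₁) x₁ N₁ ×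
      (∀ y₁ → N₁ y₁ → Σ (Pt M₂) λ y₂ → N₂ y₂ × Z y₁ y₂)) ×
  (∀ N₁ → 𝒩 (space M₁) x₁ N₁ → Σ (Subset (Pt M₂)) λ N₂ → 𝒩 (space M₂) x₂ N₂ ×
      (∀ y₂ → N₂ y₂ → Σ (Pt M₁) λ y₁ → N₁ y₁ × Z y₁ y₂))

record PathPresBisim {Atom : Set} (M₁ M₂ : QDModel Atom) : Set₂ where
  field
    Z𝒩 : Pt M₁ → Pt M₂ → Set
    Z₁ : Path M₁ → ℕ → Path M₂ → ℕ → Set
    Z₂ : Path M₂ → ℕ → Path M₁ → ℕ → Set
    nonEmpty : Σ (Pt M₁) λ x₁ → Σ (Pt M₂) λ x₂ → Z𝒩 x₁ x₂
    cond1 : ∀ x₁ x₂ → Z𝒩 x₁ x₂ → NbhdBisimAt M₁ M₂ Z𝒩 x₁ x₂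
    cond2 : ∀ x₁ x₂ → Z𝒩 x₁ x₂ → (p : Path M₁) → proj₁ p 0 ≡ x₁ → ∀ n → ¬ n ≡ 0 →
      Σ (Path M₂) λ q → Σ ℕ λ m → proj₁ q 0 ≡ x₂ × Z𝒩 (proj₁ p n) (proj₁ q m) × Z₁ p n q m
    cond3 : ∀ x₁ x₂ → Z𝒩 x₁ x₂ → (p : Path M₁) → ∀ n → proj₁ p n ≡ x₁ → ¬ n ≡ 0 →
      Σ (Path M₂) λ q → Σ ℕ λ m → proj₁ q m ≡ x₂ × Z𝒩 (proj₁ p 0) (proj₁ q 0) × Z₁ p n q m
    cond4 : ∀ p n q m → Z₁ p n q m → ∀ kq → 0 < kq → kq < m →
      Σ ℕ λ kp → 0 < kp × kp < n × Z𝒩 (proj₁ p kp) (proj₁ q kq)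
    cond5 : ∀ x₁ x₂ → Z𝒩 x₁ x₂ → (q : Path M₂) → proj₁ q 0 ≡ x₂ → ∀ m → ¬ m ≡ 0 →
      Σ (Path M₁) λ p → Σ ℕ λ n → proj₁ p 0 ≡ x₁ × Z𝒩 (proj₁ p n) (proj₁ q m) × Z₂ q m p n
    cond6 : ∀ x₁ x₂ → Z𝒩 x₁ x₂ → (q : Path M₂) → ∀ m → proj₁ q m ≡ x₂ → ¬ m ≡ 0 →
      Σ (Path M₁) λ p → Σ ℕ λ n → proj₁ p n ≡ x₁ × Z𝒩 (proj₁ p 0) (proj₁ q 0) × Z₂ q m p n
    cond7 : ∀ q m p n → Z₂ q m p n → ∀ kp → 0 < kp → kp < n →
      Σ ℕ λ kq → 0 < kq × kq < m × Z𝒩 (proj₁ p kp) (proj₁ q kq)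

module Submission where

-- The point is that path preserving bisimilarity cannot see topological
-- structure when the valuation carries no information.  We prove the general
-- fact (totalBisim): if every point of M₁ and every point of M₂ satisfy the
-- same atoms, and both models are inhabited, the total relation is a path
-- preserving bisimulation.  The neighbourhood conditions hold because every
-- neighbourhood of a point contains that point; each path is answered by a
-- constant path (constantPath), matched at index 1, so that the betweenness
-- conditions (4) and (7) quantify over the empty range 0 < k < 1.
--
-- The theorem then instantiates this with the one-point space (topological)
-- and the index space ℕ itself (quasi-discrete but not topological, since
-- {0, 1} is a neighbourhood of 0 but not of its point 1), both with the
-- empty valuation.

open import Defs
open import Data.Product using (Σ; _×_; _,_; proj₁)
open import Data.Sum using (_⊎_; inj₁; inj₂)
open import Data.Unit using (⊤; tt)
open import Data.Empty using (⊥; ⊥-elim)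
open import Data.Nat using (ℕ; suc; _<_; s≤s; z≤n)
open import Relation.Nullary using (¬_)
open import Relation.Binary.PropositionalEquality using (_≡_; refl)
open import Function.Bundles using (_⇔_; mk⇔)

memberOfNbhd : (S : NbhdSpace) (x : Carrier S) (N : Subset (Carrier S)) →
  𝒩 S x N → N x
memberOfNbhd S x = IsPointFilter.contains (isFilt S x)

constantPath : {Atom : Set} (M : QDModel Atom) → Pt M → Path M
constantPath M c = (λ _ → c) , λ _ N c∈N →
  memberOfNbhd (space M) c N c∈N , memberOfNbhd (space M) c N c∈N

-- No index lies strictly between 0 and 1; this makes (4) and (7) vacuous
-- for pairs matched at index 1.
nothingBelowOne : ∀ k → 0 < k → k < 1 → ⊥
nothingBelowOne _ (s≤s z≤n) (s≤s ())

UniformlyAlike : {Atom : Set} (M₁ M₂ : QDModel Atom) → Set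
UniformlyAlike M₁ M₂ = ∀ y₁ y₂ a → V M₁ y₁ a ⇔ V M₂ y₂ a

-- The total relation satisfies the neighbourhood bisimulation conditions:
-- the whole space answers any neighbourhood on the other side, since the
-- other point lies in its own neighbourhoods.
totalNbhdBisim : {Atom : Set} (M₁ M₂ : QDModel Atom) → UniformlyAlike M₁ M₂ →
  ∀ x₁ x₂ → NbhdBisimAt M₁ M₂ (λ _ _ → ⊤) x₁ x₂
totalNbhdBisim M₁ M₂ alike x₁ x₂ =
  alike x₁ x₂ ,
  (λ N₂ N₂∈𝒩 → Full (Pt M₁) , IsPointFilter.full (isFilt (space M₁) x₁) ,
     λ _ _ → x₂ , memberOfNbhd (space M₂) x₂ N₂ N₂∈𝒩 , tt) ,
  (λ N₁ N₁∈𝒩 → Full (Pt M₂) , IsPointFilter.full (isFilt (space M₂) x₂) ,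
     λ _ _ → x₁ , memberOfNbhd (space M₁) x₁ N₁ N₁∈𝒩 , tt)

totalBisim : {Atom : Set} (M₁ M₂ : QDModel Atom) → Pt M₁ → Pt M₂ →
  UniformlyAlike M₁ M₂ → PathPresBisim M₁ M₂
totalBisim M₁ M₂ x₁ x₂ alike = record
  { Z𝒩 = λ _ _ → ⊤
  ; Z₁ = λ _ _ _ m → m ≡ 1
  ; Z₂ = λ _ _ _ n → n ≡ 1
  ; nonEmpty = x₁ , x₂ , tt
  ; cond1 = λ y₁ y₂ _ → totalNbhdBisim M₁ M₂ alike y₁ y₂
  ; cond2 = λ _ y₂ _ _ _ _ _ → constantPath M₂ y₂ , 1 , refl , tt , refl
  ; cond3 = λ _ y₂ _ _ _ _ _ → constantPath M₂ y₂ , 1 , refl , tt , refl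
  ; cond4 = λ { _ _ _ _ refl k 0<k k<1 → ⊥-elim (nothingBelowOne k 0<k k<1) }
  ; cond5 = λ y₁ _ _ _ _ _ _ → constantPath M₁ y₁ , 1 , refl , tt , refl
  ; cond6 = λ y₁ _ _ _ _ _ _ → constantPath M₁ y₁ , 1 , refl , tt , refl
  ; cond7 = λ { _ _ _ _ refl k 0<k k<1 → ⊥-elim (nothingBelowOne k 0<k k<1) }
  }

pointSpace : NbhdSpace
pointSpace = record
  { Carrier = ⊤
  ; 𝒩 = λ _ N → N tt
  ; isFilt = λ _ → record
      { full = tt
      ; inter = λ _ _ a b → a , b
      ; upward = λ _ _ a A⊆B → A⊆B tt a
      ; nonempty = λ z → z
      ; contains = λ _ a → a
      }
  }

pointQuasiDiscrete : QuasiDiscrete pointSpace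
pointQuasiDiscrete _ = Full ⊤ , tt , λ _ tt∈N _ _ → tt∈N

pointTopological : Topological pointSpace
pointTopological _ _ tt∈N = Full ⊤ , tt , λ _ _ → tt∈N

ℕQuasiDiscrete : QuasiDiscrete ℕspace
ℕQuasiDiscrete n = (λ y → y ≡ n ⊎ y ≡ suc n) , (inj₁ refl , inj₂ refl) ,
  λ { _ (n∈N , _) _ (inj₁ refl) → n∈N ; _ (_ , sn∈N) _ (inj₂ refl) → sn∈N }

-- The index space is not topological: {0, 1} is a neighbourhood of 0, so any
-- witness M contains 1, but {0, 1} is not a neighbourhood of 1 as 2 ∉ {0, 1}.
ℕNotTopological : ¬ Topological ℕspace
ℕNotTopological top
  with top 0 (λ y → y < 2) (s≤s z≤n , s≤s (s≤s z≤n))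
... | _ , (_ , 1∈M) , nbhdOfAll with nbhdOfAll 1 1∈M
... | _ , s≤s (s≤s ())

pointModel : (Atom : Set) → QDModel Atom
pointModel _ = record { space = pointSpace ; qd = pointQuasiDiscrete ; V = λ _ _ → ⊥ }

ℕModel : (Atom : Set) → QDModel Atom
ℕModel _ = record { space = ℕspace ; qd = ℕQuasiDiscrete ; V = λ _ _ → ⊥ }

lemma22 : (Atom : Set) → Σ (QDModel Atom) λ M₁ → Σ (QDModel Atom) λ M₂ →
    PathPresBisim M₁ M₂ × Topological (space M₁) × ¬ Topological (space M₂)
lemma22 Atom =
  pointModel Atom , ℕModel Atom ,
  totalBisim (pointModel Atom) (ℕModel Atom) tt 0 emptyValuationsAlike ,
  pointTopological , ℕNotTopological
  where
  emptyValuationsAlike : UniformlyAlike (pointModel Atom) (ℕModel Atom)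
  emptyValuationsAlike _ _ _ = mk⇔ (λ v → v) (λ v → v)
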